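{- Let $n\ge4$, $m=n-2$, and run the procedure described in the context on the straight linear 2-tree $G_n$ with unit resistances. Then for every $k$ with $1\le k\le m-1$, at the $k$-th $\Delta$–Y transformation \[ R_A^k+R_B^k+R_C^k=\frac{F_{2k+2}}{F_{2k}}. \]
   Context: $G_n$ is the graph on $\{1,\dots,n\}$ with $\{i,j\}$ an edge iff $0<|i-j|\le2$, each edge a resistor of resistance $1$. A $\Delta$–Y transformation replaces a triangle on nodes $N_1,N_2,N_3$ with resistances $R_C$ on $\{N_1,N_2\}$, $R_B$ on $\{N_1,N_3\}$, $R_A$ on $\{N_2,N_3\}$ by a new node $*$ joined to $N_1,N_2,N_3$ with resistances $R_1=\frac{R_BR_C}{R_A+R_B+R_C}$, $R_2=\frac{R_AR_C}{R_A+R_B+R_C}$, $R_3=\frac{R_AR_B}{R_A+R_B+R_C}$ respectively; a series transformation replaces a degree-2 node joined by resistances $a,b$ to two nodes by a single edge of resistance $a+b$. Procedure: for $k=1,2,\dots,m-1$ in turn, the current network contains a triangle on vertices $k,k+1,k+2$; let $R_A^k,R_B^k,R_C^k$ be the resistances of its edges $\{k,k+1\},\{k,k+2\},\{k+1,k+2\}$. Replace it by a Y with new center $*$, with resistance $t_k=\frac{R_A^kR_B^k}{R_A^k+R_B^k+R_C^k}$ on $\{*,k\}$, $s_k=\frac{R_A^kR_C^k}{R_A^k+R_B^k+R_C^k}$ on $\{*,k+1\}$, $b_k=\frac{R_B^kR_C^k}{R_A^k+R_B^k+R_C^k}$ on $\{*,k+2\}$. Vertex $k+1$ now has neighbours only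 $*$ and $k+3$; replace the path $*,k+1,k+3$ by one edge $\{*,k+3\}$ of resistance $s_k+1$, delete vertex $k+1$, and rename $*$ as $k+1$. $F_p$ are the Fibonacci numbers ($F_0=0,F_1=1,F_{p+1}=F_p+F_{p-1}$). -}

module Defs where

open import Data.Nat as ℕ using (ℕ; zero; suc; _≤_; _≤ᵇ_)
open import Data.Bool using (Bool; true; false; if_then_else_; _∧_; _∨_)
open import Data.Maybe using (Maybe; just; nothing; fromMaybe)
open import Data.Integer using (+_)
open import Data.Rational using (ℚ; 0ℚ; 1ℚ; _+_; _*_; _÷_; _/_; ≢-nonZero)
open import Data.Rational.Properties using (_≟_)
open import Relation.Nullary using (yes; no)
open import Data.Nat.Properties using (+-suc)

fib : ℕ → ℕ
fib 0 = 0
fib 1 = 1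
fib (suc (suc p)) = fib (suc p) ℕ.+ fib p

fib-suc-nonZero : ∀ p → ℕ.NonZero (fib (suc p))
fib-suc-nonZero zero = _
fib-suc-nonZero (suc p) with fib (suc p) | fib-suc-nonZero p
... | suc x | _ = _

fib2k-nonZero : ∀ k → 1 ≤ k → ℕ.NonZero (fib (2 ℕ.* k))
fib2k-nonZero (suc k) _ rewrite +-suc k (k ℕ.+ 0) =
  fib-suc-nonZero (suc (k ℕ.+ (k ℕ.+ 0)))

-- division of rationals; returns 0 on a zero denominator (never happens in the procedure)
_//_ : ℚ → ℚ → ℚ
p // q with q ≟ 0ℚ
... | yes _ = 0ℚ
... | no q≢0 = (p ÷ q) {{≢-nonZero q≢0}}

-- A resistor network on vertex labels ℕ: N i j = just r iff {i,j} is an edge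
-- of resistance r (always used symmetrically).  Label 0 is never a vertex of G_n
-- and serves as the fresh centre * of a Y.
Net : Set
Net = ℕ → ℕ → Maybe ℚ

_==_ : ℕ → ℕ → Bool
i == j = (i ≤ᵇ j) ∧ (j ≤ᵇ i)

Gn : ℕ → Net
Gn n i j =
  if (1 ≤ᵇ i) ∧ (i ≤ᵇ n) ∧ (1 ≤ᵇ j) ∧ (j ≤ᵇ n) ∧ (adj i j ∨ adj j i)
  then just 1ℚ else nothing
  where
  adj : ℕ → ℕ → Bool
  adj a b = (suc a ≤ᵇ b) ∧ (b ≤ᵇ a ℕ.+ 2)

-- resistance of edge {i,j} (0 if absent; only used on edges that exist)
res : Net → ℕ → ℕ → ℚ
res N i j = fromMaybe 0ℚ (N i j)

setE : Net → ℕ → ℕ → Maybe ℚ → Net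
setE N i j v x y =
  if ((x == i) ∧ (y == j)) ∨ ((x == j) ∧ (y == i)) then v else N x y

delV : Net → ℕ → Net
delV N v x y = if (x == v) ∨ (y == v) then nothing else N x y

-- rename vertex a as b (b currently isolated): swap the labels a and b
swapV : ℕ → ℕ → ℕ → ℕ
swapV a b x = if x == a then b else (if x == b then a else x)

rename : Net → ℕ → ℕ → Net
rename N a b x y = N (swapV a b x) (swapV a b y)

RA RB RC : ℕ → Net → ℚ
RA k N = res N k (suc k)
RB k N = res N k (suc (suc k))
RC k N = res N (suc k) (suc (suc k))

star : ℕ
star = 0

step : ℕ → Net → Net
step k N = N3
  where
  S  = RA k N + RB k N + RC k N
  tk = (RA k N * RB k N) // S
  sk = (RA k N * RC k N) // S
  bk = (RB k N * RC k N) // S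
  -- Δ–Y: remove triangle edges, add centre * joined to k, k+1, k+2
  N0 = setE (setE (setE N k (suc k) nothing) k (suc (suc k)) nothing)
            (suc k) (suc (suc k)) nothing
  N1 = setE (setE (setE N0 star k (just tk)) star (suc k) (just sk))
            star (suc (suc k)) (just bk)
  -- series: replace path *, k+1, k+3 by edge {*,k+3} of resistance s_k + 1
  r  = res N1 star (suc k) + res N1 (suc k) (3 ℕ.+ k)
  N2 = setE (delV N1 (suc k)) star (3 ℕ.+ k) (just r)
  N3 = rename N2 star (suc k)

after : ℕ → ℕ → Net
after n zero = Gn n
after n (suc j) = step (suc j) (after n j)

{-# OPTIONS --safe #-}
-- Step k leaves the network beyond vertex k + 1 equal to the unit-resistance G_n, and turns
-- the next triangle into one with resistances b_k, s_k + 1 and 1.  As R_C^k = 1, the sums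
-- S_k = R_A^k + R_B^k + R_C^k satisfy S_{k+1} = (R_A^k + R_B^k)/S_k + 2 = 3 - 1/S_k and
-- S_1 = 3, while F_{2k+4} = 3 F_{2k+2} - F_{2k} shows that F_{2k+2}/F_{2k} obeys the same
-- recurrence.  The induction carries S_k F_{2k} = F_{2k+2}, which also keeps S_k nonzero.
module Submission where

open import Defs
open import Data.Bool using (true; false; if_then_else_; _∧_; T)
open import Data.Bool.Properties using (T-≡; T-∧; T-∨; ∧-zeroʳ)
open import Data.Integer as ℤ using (+_)
import Data.Integer.Properties as ℤ
open import Data.Maybe using (just; nothing; fromMaybe)
open import Data.Nat as ℕ using (ℕ; zero; suc; _≤_; _∸_; s≤s; z≤n)
open import Data.Nat.Properties
  using (+-comm; *-identityʳ; ≤-refl; ≤-trans; ≤-antisym; n≤1+n; m≤n+m; <⇒≢; >⇒≢; ≤⇒≤ᵇ; ≤ᵇ⇒≤; m≤o∸n⇒m+n≤o)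
open import Data.Nat.Tactic.RingSolver as ℕ-Solver using ()
open import Data.Product using (_,_)
open import Data.Rational using (ℚ; mkℚ; 0ℚ; 1ℚ; _+_; _*_; _-_; _/_; toℚᵘ; ≢-nonZero)
open import Data.Rational.Literals using (fromℤ)
open import Data.Rational.Properties
  using (_≟_; *-zeroˡ; *-identityˡ; *-inverseʳ; toℚᵘ-injective; toℚᵘ-fromℚᵘ; toℚᵘ-homo-+; toℚᵘ-homo-*)
open import Data.Rational.Solver using (module +-*-Solver)
open import Data.Rational.Unnormalised as ℚᵘ using (mkℚᵘ; *≡*)
import Data.Rational.Unnormalised.Properties as ℚᵘ
open import Data.Sum using (_⊎_; inj₁; inj₂)
open import Function using (_∘_)
open import Function.Bundles using (Equivalence)
open import Relation.Binary.PropositionalEquality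
open import Relation.Nullary using (yes; no; contradiction)

==-refl : ∀ x → (x == x) ≡ true
==-refl x = Equivalence.to T-≡ (Equivalence.from T-∧ (≤⇒≤ᵇ (≤-refl {x}) , ≤⇒≤ᵇ (≤-refl {x})))

==-≢ : ∀ {x y} → x ≢ y → (x == y) ≡ false
==-≢ {x} {y} x≢y with x == y in eq
... | false = refl
... | true with Equivalence.to T-∧ (subst T (sym eq) _)
...   | x≤y , y≤x = contradiction (≤-antisym (≤ᵇ⇒≤ x y x≤y) (≤ᵇ⇒≤ y x y≤x)) x≢y

∧-==-≢ : ∀ {x y i j} → x ≢ i ⊎ y ≢ j → ((x == i) ∧ (y == j)) ≡ false
∧-==-≢ (inj₁ x≢i) rewrite ==-≢ x≢i = refl
∧-==-≢ {x} {i = i} (inj₂ y≢j) rewrite ==-≢ y≢j = ∧-zeroʳ (x == i)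

setE-hit : ∀ N i j v → setE N i j v i j ≡ v
setE-hit N i j v rewrite ==-refl i | ==-refl j = refl

setE-miss : ∀ N i j v x y → x ≢ i ⊎ y ≢ j → x ≢ j ⊎ y ≢ i → setE N i j v x y ≡ N x y
setE-miss N i j v x y h₁ h₂ rewrite ∧-==-≢ h₁ | ∧-==-≢ h₂ = refl

delV-miss : ∀ N v x y → x ≢ v → y ≢ v → delV N v x y ≡ N x y
delV-miss N v x y x≢v y≢v rewrite ==-≢ x≢v | ==-≢ y≢v = refl

swapV-right : ∀ a b → a ≢ b → swapV a b b ≡ a
swapV-right a b a≢b rewrite ==-≢ (a≢b ∘ sym) | ==-refl b = refl

swapV-other : ∀ a b {x} → x ≢ a → x ≢ b → swapV a b x ≡ x
swapV-other a b x≢a x≢b rewrite ==-≢ x≢a | ==-≢ x≢b = refl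

n≢1+o+n : ∀ o n → n ≢ suc (o ℕ.+ n)
n≢1+o+n o n = <⇒≢ (s≤s (m≤n+m n o))

triangleSum : ℕ → Net → ℚ
triangleSum k N = RA k N + RB k N + RC k N

tₖ sₖ bₖ : ℕ → Net → ℚ
tₖ k N = (RA k N * RB k N) // triangleSum k N
sₖ k N = (RA k N * RC k N) // triangleSum k N
bₖ k N = (RB k N * RC k N) // triangleSum k N

ΔRemoved withArmₜ withArmsₜₛ YInserted seriesReduced : ℕ → Net → Net
ΔRemoved k N =
  setE (setE (setE N k (suc k) nothing) k (suc (suc k)) nothing) (suc k) (suc (suc k)) nothing
withArmₜ k N = setE (ΔRemoved k N) star k (just (tₖ k N))
withArmsₜₛ k N = setE (withArmₜ k N) star (suc k) (just (sₖ k N))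
YInserted k N = setE (withArmsₜₛ k N) star (suc (suc k)) (just (bₖ k N))
seriesReduced k N =
  setE (delV (YInserted k N) (suc k)) star (3 ℕ.+ k)
       (just (res (YInserted k N) star (suc k) + res (YInserted k N) (suc k) (3 ℕ.+ k)))

YInserted-away : ∀ k N {x y} → x ≢ star → y ≢ star → x ≢ k → y ≢ k →
  x ≢ suc k ⊎ y ≢ suc (suc k) → x ≢ suc (suc k) ⊎ y ≢ suc k → YInserted k N x y ≡ N x y
YInserted-away k N {x} {y} x≢⋆ y≢⋆ x≢k y≢k h₁ h₂ =
  trans (setE-miss (withArmsₜₛ k N) star (suc (suc k)) _ x y (inj₁ x≢⋆) (inj₂ y≢⋆))
  (trans (setE-miss (withArmₜ k N) star (suc k) _ x y (inj₁ x≢⋆) (inj₂ y≢⋆))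
  (trans (setE-miss (ΔRemoved k N) star k _ x y (inj₁ x≢⋆) (inj₂ y≢⋆))
  (trans (setE-miss N₂ (suc k) (suc (suc k)) _ x y h₁ h₂)
  (trans (setE-miss N₁ k (suc (suc k)) _ x y (inj₁ x≢k) (inj₂ y≢k))
         (setE-miss N k (suc k) _ x y (inj₁ x≢k) (inj₂ y≢k))))))
  where
  N₁ N₂ : Net
  N₁ = setE N k (suc k) nothing
  N₂ = setE N₁ k (suc (suc k)) nothing

step-far : ∀ k N {x y} → suc (suc k) ≤ x → suc (suc k) ≤ y → step k N x y ≡ N x y
step-far k N {x} {y} 2+k≤x 2+k≤y = begin
  seriesReduced k N (swapV star (suc k) x) (swapV star (suc k) y)
    ≡⟨ cong₂ (seriesReduced k N) (swapV-other star (suc k) x≢⋆ x≢1+k)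
                                 (swapV-other star (suc k) y≢⋆ y≢1+k) ⟩
  seriesReduced k N x y
    ≡⟨ setE-miss (delV (YInserted k N) (suc k)) star (3 ℕ.+ k) _ x y (inj₁ x≢⋆) (inj₂ y≢⋆) ⟩
  delV (YInserted k N) (suc k) x y
    ≡⟨ delV-miss (YInserted k N) (suc k) x y x≢1+k y≢1+k ⟩
  YInserted k N x y
    ≡⟨ YInserted-away k N {x} {y} x≢⋆ y≢⋆ x≢k y≢k (inj₁ x≢1+k) (inj₂ y≢1+k) ⟩
  N x y ∎
  where
  open ≡-Reasoning
  x≢⋆ : x ≢ star
  y≢⋆ : y ≢ star
  x≢k : x ≢ k
  y≢k : y ≢ k
  x≢1+k : x ≢ suc k
  y≢1+k : y ≢ suc k
  x≢1+k = >⇒≢ 2+k≤x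
  y≢1+k = >⇒≢ 2+k≤y
  x≢k = >⇒≢ (≤-trans (n≤1+n (suc k)) 2+k≤x)
  y≢k = >⇒≢ (≤-trans (n≤1+n (suc k)) 2+k≤y)
  x≢⋆ = >⇒≢ (≤-trans (s≤s z≤n) 2+k≤x)
  y≢⋆ = >⇒≢ (≤-trans (s≤s z≤n) 2+k≤y)

RA-step : ∀ k N → RA (suc k) (step k N) ≡ bₖ k N
RA-step k N = cong (fromMaybe 0ℚ) (begin
  seriesReduced k N (swapV star (suc k) (suc k)) (swapV star (suc k) (suc (suc k)))
    ≡⟨ cong₂ (seriesReduced k N) (swapV-right star (suc k) (λ ()))
                                 (swapV-other star (suc k) (λ ()) (≢-sym (n≢1+o+n 0 (suc k)))) ⟩
  seriesReduced k N star (suc (suc k))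
    ≡⟨ setE-miss (delV (YInserted k N) (suc k)) star (3 ℕ.+ k) _ star (suc (suc k))
         (inj₂ (n≢1+o+n 0 (suc (suc k)))) (inj₁ (λ ())) ⟩
  delV (YInserted k N) (suc k) star (suc (suc k))
    ≡⟨ delV-miss (YInserted k N) (suc k) star (suc (suc k)) (λ ()) (≢-sym (n≢1+o+n 0 (suc k))) ⟩
  YInserted k N star (suc (suc k))
    ≡⟨ setE-hit (withArmsₜₛ k N) star (suc (suc k)) _ ⟩
  just (bₖ k N) ∎)
  where open ≡-Reasoning

RB-step : ∀ k N → RB (suc k) (step k N) ≡ sₖ k N + res N (suc k) (3 ℕ.+ k)
RB-step k N = begin
  res (seriesReduced k N) (swapV star (suc k) (suc k)) (swapV star (suc k) (3 ℕ.+ k))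
    ≡⟨ cong₂ (res (seriesReduced k N)) (swapV-right star (suc k) (λ ()))
                                       (swapV-other star (suc k) (λ ()) (≢-sym (n≢1+o+n 1 (suc k)))) ⟩
  res (seriesReduced k N) star (3 ℕ.+ k)
    ≡⟨ cong (fromMaybe 0ℚ) (setE-hit (delV (YInserted k N) (suc k)) star (3 ℕ.+ k) _) ⟩
  res (YInserted k N) star (suc k) + res (YInserted k N) (suc k) (3 ℕ.+ k)
    ≡⟨ cong₂ _+_ (cong (fromMaybe 0ℚ) centre-arm) (cong (fromMaybe 0ℚ) outer-edge) ⟩
  sₖ k N + res N (suc k) (3 ℕ.+ k) ∎
  where
  open ≡-Reasoning
  centre-arm : YInserted k N star (suc k) ≡ just (sₖ k N)
  centre-arm = trans (setE-miss (withArmsₜₛ k N) star (suc (suc k)) _ star (suc k) (inj₂ (n≢1+o+n 0 (suc k))) (inj₁ (λ ())))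
                     (setE-hit (withArmₜ k N) star (suc k) _)
  outer-edge : YInserted k N (suc k) (3 ℕ.+ k) ≡ N (suc k) (3 ℕ.+ k)
  outer-edge = YInserted-away k N (λ ()) (λ ()) (≢-sym (n≢1+o+n 0 k)) (≢-sym (n≢1+o+n 2 k))
    (inj₂ (≢-sym (n≢1+o+n 0 (suc (suc k))))) (inj₁ (n≢1+o+n 0 (suc k)))

RC-step : ∀ k N → RC (suc k) (step k N) ≡ res N (suc (suc k)) (3 ℕ.+ k)
RC-step k N = cong (fromMaybe 0ℚ) (step-far k N ≤-refl (n≤1+n _))

after-far : ∀ n j {x y} → suc (suc j) ≤ x → suc (suc j) ≤ y → after n j x y ≡ Gn n x y
after-far n zero _ _ = refl
after-far n (suc j) {x} {y} 3+j≤x 3+j≤y =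
  trans (step-far (suc j) (after n j) {x} {y} 3+j≤x 3+j≤y)
        (after-far n j (≤-trans (n≤1+n _) 3+j≤x) (≤-trans (n≤1+n _) 3+j≤y))

if-T : ∀ {a} {A : Set a} {b} {x y : A} → T b → (if b then x else y) ≡ x
if-T {b = true} _ = refl

Gn-edge : ∀ n {x y} → 1 ≤ x → suc x ≤ y → y ≤ 2 ℕ.+ x → y ≤ n → Gn n x y ≡ just 1ℚ
Gn-edge n {x} {y} 1≤x x<y y≤2+x y≤n =
  if-T (∧-intro (≤⇒≤ᵇ 1≤x) (∧-intro (≤⇒≤ᵇ (≤-trans (n≤1+n x) (≤-trans x<y y≤n)))
       (∧-intro (≤⇒≤ᵇ (≤-trans (s≤s z≤n) x<y)) (∧-intro (≤⇒≤ᵇ y≤n)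
       (Equivalence.from T-∨ (inj₁ (∧-intro (≤⇒≤ᵇ x<y) (≤⇒≤ᵇ (subst (y ≤_) (+-comm 2 x) y≤2+x)))))))))
  where
  ∧-intro : ∀ {a b} → T a → T b → T (a ∧ b)
  ∧-intro p q = Equivalence.from T-∧ (p , q)

Gn-unit-edge : ∀ n {x y} → 1 ≤ x → suc x ≤ y → y ≤ 2 ℕ.+ x → y ≤ n → res (Gn n) x y ≡ 1ℚ
Gn-unit-edge n 1≤x x<y y≤2+x y≤n = cong (fromMaybe 0ℚ) (Gn-edge n 1≤x x<y y≤2+x y≤n)

after-unit-edge : ∀ n i {x y} → suc (suc i) ≤ x → suc x ≤ y → y ≤ 2 ℕ.+ x → y ≤ n →
  res (after n i) x y ≡ 1ℚ
after-unit-edge n i 2+i≤x x<y y≤2+x y≤n =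
  trans (cong (fromMaybe 0ℚ) (after-far n i 2+i≤x (≤-trans 2+i≤x (≤-trans (n≤1+n _) x<y))))
        (Gn-unit-edge n (≤-trans (s≤s z≤n) 2+i≤x) x<y y≤2+x y≤n)

-- Unlike + n / 1 this involves no normalisation: toℚᵘ (ι n) is definitionally mkℚᵘ (+ n) 0.
ι : ℕ → ℚ
ι n = fromℤ (+ n)

ι-+ : ∀ a b → ι (a ℕ.+ b) ≡ ι a + ι b
ι-+ a b = toℚᵘ-injective (ℚᵘ.≃-trans (*≡* cross) (ℚᵘ.≃-sym (toℚᵘ-homo-+ (ι a) (ι b))))
  where
  cross : + (a ℕ.+ b) ℤ.* + 1 ≡ (+ a ℤ.* + 1 ℤ.+ + b ℤ.* + 1) ℤ.* + 1
  cross = cong (ℤ._* + 1) (trans (ℤ.pos-+ a b)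
            (sym (cong₂ ℤ._+_ (ℤ.*-identityʳ (+ a)) (ℤ.*-identityʳ (+ b)))))

ι-≢0 : ∀ p → .{{ℕ.NonZero p}} → ι p ≢ 0ℚ
ι-≢0 (suc p) ()

x*y≢0⇒x≢0 : ∀ x y → x * y ≢ 0ℚ → x ≢ 0ℚ
x*y≢0⇒x≢0 x y xy≢0 x≡0 = xy≢0 (trans (cong (_* y) x≡0) (*-zeroˡ y))

//-≡-*-1// : ∀ p q → q ≢ 0ℚ → p // q ≡ p * (1ℚ // q)
//-≡-*-1// p q q≢0 with q ≟ 0ℚ
... | yes q≡0 = contradiction q≡0 q≢0
... | no q≢0' = cong (p *_) (sym (*-identityˡ _))

*-1//-inverseʳ : ∀ q → q ≢ 0ℚ → q * (1ℚ // q) ≡ 1ℚ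
*-1//-inverseʳ q q≢0 with q ≟ 0ℚ
... | yes q≡0 = contradiction q≡0 q≢0
... | no q≢0' = trans (cong (q *_) (*-identityˡ _)) (*-inverseʳ q {{≢-nonZero q≢0'}})

Y-sum-recurrence : ∀ a b c → c ≡ 1ℚ → a + b + c ≢ 0ℚ →
  (b * c) // (a + b + c) + ((a * c) // (a + b + c) + 1ℚ) + 1ℚ ≡ ι 3 - 1ℚ // (a + b + c)
Y-sum-recurrence a b .1ℚ refl S≢0 = begin
  (b * 1ℚ) // S + ((a * 1ℚ) // S + 1ℚ) + 1ℚ
    ≡⟨ cong₂ (λ u v → u + (v + 1ℚ) + 1ℚ) (//-≡-*-1// (b * 1ℚ) S S≢0) (//-≡-*-1// (a * 1ℚ) S S≢0) ⟩
  (b * 1ℚ) * inv + ((a * 1ℚ) * inv + 1ℚ) + 1ℚ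
    ≡⟨ solve 3 (λ a b inv → (b :* con 1ℚ) :* inv :+ ((a :* con 1ℚ) :* inv :+ con 1ℚ) :+ con 1ℚ
                          := con (ι 3) :- inv :+ ((a :+ b :+ con 1ℚ) :* inv :- con 1ℚ)) refl a b inv ⟩
  ι 3 - inv + (S * inv - 1ℚ)
    ≡⟨ cong (λ z → ι 3 - inv + (z - 1ℚ)) (*-1//-inverseʳ S S≢0) ⟩
  ι 3 - inv + (1ℚ - 1ℚ)
    ≡⟨ solve 1 (λ inv → con (ι 3) :- inv :+ (con 1ℚ :- con 1ℚ) := con (ι 3) :- inv) refl inv ⟩
  ι 3 - inv ∎
  where
  open ≡-Reasoning
  open +-*-Solver
  S inv : ℚ
  S = a + b + 1ℚ
  inv = 1ℚ // S

ratio-recurrence : ∀ s p q p′ → s * ι q ≡ ι p → ι p ≢ 0ℚ → p′ ℕ.+ q ≡ p ℕ.+ p ℕ.+ p →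
  (ι 3 - 1ℚ // s) * ι p ≡ ι p′
ratio-recurrence s p q p′ sq≡p p≢0 p′+q≡3p = begin
  (ι 3 - inv) * P
    ≡⟨ solve 2 (λ inv P → (con (ι 3) :- inv) :* P := P :+ P :+ P :- inv :* P) refl inv P ⟩
  P + P + P - inv * P
    ≡⟨ cong (λ z → P + P + P - inv * z) (sym sq≡p) ⟩
  P + P + P - inv * (s * Q)
    ≡⟨ solve 4 (λ P inv s Q → P :+ P :+ P :- inv :* (s :* Q) := P :+ P :+ P :- (s :* inv) :* Q)
             refl P inv s Q ⟩
  P + P + P - (s * inv) * Q
    ≡⟨ cong (λ z → P + P + P - z * Q) (*-1//-inverseʳ s (x*y≢0⇒x≢0 s Q (p≢0 ∘ trans (sym sq≡p)))) ⟩
  P + P + P - 1ℚ * Q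
    ≡⟨ cong (λ z → z - 1ℚ * Q) (sym p′+q≡3pℚ) ⟩
  ι p′ + Q - 1ℚ * Q
    ≡⟨ solve 2 (λ P′ Q → P′ :+ Q :- con 1ℚ :* Q := P′) refl (ι p′) Q ⟩
  ι p′ ∎
  where
  open ≡-Reasoning
  open +-*-Solver
  P Q inv : ℚ
  P = ι p
  Q = ι q
  inv = 1ℚ // s
  p′+q≡3pℚ : ι p′ + Q ≡ P + P + P
  p′+q≡3pℚ = begin
    ι p′ + Q            ≡⟨ ι-+ p′ q ⟨
    ι (p′ ℕ.+ q)        ≡⟨ cong ι p′+q≡3p ⟩
    ι (p ℕ.+ p ℕ.+ p)   ≡⟨ ι-+ (p ℕ.+ p) p ⟩
    ι (p ℕ.+ p) + P     ≡⟨ cong (_+ P) (ι-+ p p) ⟩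
    P + P + P           ∎

x*q≡p⇒x≡p/q : ∀ x p q .{{_ : ℕ.NonZero q}} → x * ι q ≡ ι p → x ≡ + p / q
x*q≡p⇒x≡p/q x@(mkℚ n d _) p (suc q) xq≡p =
  toℚᵘ-injective (ℚᵘ.≃-trans (*≡* cross) (ℚᵘ.≃-sym (toℚᵘ-fromℚᵘ (mkℚᵘ (+ p) q))))
  where
  cross₁ : (n ℤ.* + suc q) ℤ.* + 1 ≡ + p ℤ.* + (suc d ℕ.* 1)
  cross₁ = ℚᵘ.drop-*≡* (ℚᵘ.≃-trans (ℚᵘ.≃-sym (toℚᵘ-homo-* x (ι (suc q))))
                                  (ℚᵘ.≃-reflexive (cong toℚᵘ xq≡p)))
  cross : n ℤ.* + suc q ≡ + p ℤ.* + suc d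
  cross = trans (sym (ℤ.*-identityʳ _)) (trans cross₁ (cong (λ m → + p ℤ.* + m) (*-identityʳ (suc d))))

fib-+4 : ∀ m → fib (m ℕ.+ 4) ℕ.+ fib m ≡ fib (m ℕ.+ 2) ℕ.+ fib (m ℕ.+ 2) ℕ.+ fib (m ℕ.+ 2)
fib-+4 m rewrite +-comm m 4 | +-comm m 2 = three-steps (fib (suc m)) (fib m)
  where
  three-steps : ∀ a b → ((a ℕ.+ b) ℕ.+ a) ℕ.+ (a ℕ.+ b) ℕ.+ b ≡
                        (a ℕ.+ b) ℕ.+ (a ℕ.+ b) ℕ.+ (a ℕ.+ b)
  three-steps = ℕ-Solver.solve-∀

double-suc : ∀ k → 2 ℕ.* suc k ≡ 2 ℕ.* k ℕ.+ 2
double-suc = ℕ-Solver.solve-∀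

fib-even-step : ∀ k → fib (2 ℕ.* suc k ℕ.+ 2) ℕ.+ fib (2 ℕ.* k) ≡
  fib (2 ℕ.* k ℕ.+ 2) ℕ.+ fib (2 ℕ.* k ℕ.+ 2) ℕ.+ fib (2 ℕ.* k ℕ.+ 2)
fib-even-step k = trans (cong (λ m → fib m ℕ.+ fib (2 ℕ.* k)) (shift k)) (fib-+4 (2 ℕ.* k))
  where
  shift : ∀ k → 2 ℕ.* suc k ℕ.+ 2 ≡ 2 ℕ.* k ℕ.+ 4
  shift = ℕ-Solver.solve-∀

triangleSum-recurrence : ∀ n i → 4 ℕ.+ i ≤ n → triangleSum (suc i) (after n i) ≢ 0ℚ →
  triangleSum (2 ℕ.+ i) (after n (suc i)) ≡ ι 3 - 1ℚ // triangleSum (suc i) (after n i)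
triangleSum-recurrence n i 4+i≤n S≢0 = begin
  triangleSum (suc k) (step k N)
    ≡⟨ cong₂ _+_ (cong₂ _+_ (RA-step k N) (RB-step k N)) (RC-step k N) ⟩
  bₖ k N + (sₖ k N + res N (suc k) (3 ℕ.+ k)) + res N (suc (suc k)) (3 ℕ.+ k)
    ≡⟨ cong₂ (λ u v → bₖ k N + (sₖ k N + u) + v)
         (after-unit-edge n i ≤-refl (n≤1+n _) ≤-refl 4+i≤n)
         (after-unit-edge n i (n≤1+n _) ≤-refl (n≤1+n _) 4+i≤n) ⟩
  bₖ k N + (sₖ k N + 1ℚ) + 1ℚ
    ≡⟨ Y-sum-recurrence (RA k N) (RB k N) (RC k N)
         (after-unit-edge n i ≤-refl ≤-refl (n≤1+n _) (≤-trans (n≤1+n _) 4+i≤n)) S≢0 ⟩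
  ι 3 - 1ℚ // triangleSum k N ∎
  where
  open ≡-Reasoning
  k : ℕ
  k = suc i
  N : Net
  N = after n i

triangleSum-ratio : ∀ n i → 3 ℕ.+ i ≤ n →
  triangleSum (suc i) (after n i) * ι (fib (2 ℕ.* suc i)) ≡ ι (fib (2 ℕ.* suc i ℕ.+ 2))
triangleSum-ratio n zero 3≤n = cong (_* ι 1)
  (cong₂ _+_ (cong₂ _+_ (Gn-unit-edge n ≤-refl ≤-refl (n≤1+n _) (≤-trans (n≤1+n 2) 3≤n))
                        (Gn-unit-edge n ≤-refl (n≤1+n _) ≤-refl 3≤n))
             (Gn-unit-edge n (s≤s z≤n) ≤-refl (n≤1+n _) 3≤n))
triangleSum-ratio n (suc i) 4+i≤n = begin
  triangleSum (2 ℕ.+ i) (after n (suc i)) * ι (fib (2 ℕ.* suc (suc i)))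
    ≡⟨ cong₂ _*_ (triangleSum-recurrence n i 4+i≤n S≢0) (cong (ι ∘ fib) (double-suc (suc i))) ⟩
  (ι 3 - 1ℚ // S) * ι (fib (2 ℕ.* suc i ℕ.+ 2))
    ≡⟨ ratio-recurrence S _ _ _ ih p≢0 (fib-even-step (suc i)) ⟩
  ι (fib (2 ℕ.* suc (suc i) ℕ.+ 2)) ∎
  where
  open ≡-Reasoning
  S : ℚ
  S = triangleSum (suc i) (after n i)
  ih : S * ι (fib (2 ℕ.* suc i)) ≡ ι (fib (2 ℕ.* suc i ℕ.+ 2))
  ih = triangleSum-ratio n i (≤-trans (n≤1+n _) 4+i≤n)
  p≢0 : ι (fib (2 ℕ.* suc i ℕ.+ 2)) ≢ 0ℚ
  p≢0 = subst (λ m → ι (fib m) ≢ 0ℚ) (+-comm 2 (2 ℕ.* suc i))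
              (ι-≢0 _ {{fib-suc-nonZero (suc (2 ℕ.* suc i))}})
  S≢0 : S ≢ 0ℚ
  S≢0 = x*y≢0⇒x≢0 S _ (p≢0 ∘ trans (sym ih))

lemma3p2 : ∀ (n : ℕ) → 4 ≤ n → ∀ (k : ℕ) (hk : 1 ≤ k) → k ≤ n ∸ 3 →
    RA k (after n (k ∸ 1)) + RB k (after n (k ∸ 1))
    + RC k (after n (k ∸ 1))
    ≡ (+ fib (2 ℕ.* k ℕ.+ 2) / fib (2 ℕ.* k)) {{fib2k-nonZero k hk}}
lemma3p2 n 4≤n (suc i) 1≤k k≤n∸3 =
  x*q≡p⇒x≡p/q _ _ _ {{fib2k-nonZero (suc i) 1≤k}} (triangleSum-ratio n i 3+i≤n)
  where
  3+i≤n : 3 ℕ.+ i ≤ n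
  3+i≤n = ≤-trans (n≤1+n _)
    (subst (_≤ n) (+-comm (suc i) 3) (m≤o∸n⇒m+n≤o (suc i) (≤-trans (n≤1+n 3) 4≤n) k≤n∸3))
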